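{- For any finite simple graph $G$, $|\operatorname{nucleus}(G)| + |\operatorname{diadem}(G)| \le 2\alpha(G)$.
   Context: For $X\subseteq V(G)$, $N(X)=\bigcup_{u\in X}N(u)$ and $d(X)=|X|-|N(X)|$. A set is independent if no two of its vertices are adjacent; $\alpha(G)$ is the maximum size of an independent set. An independent set $A$ is critical if $d(A)=\max\{d(Y): Y\subseteq V(G)\}$; the empty set may be critical. A maximum critical independent set is a critical independent set of maximum cardinality. $\operatorname{diadem}(G)$ is the union, and $\operatorname{nucleus}(G)$ the intersection, of all maximum critical independent sets of $G$. If the only critical independent set is $\emptyset$, both are empty. -}

module Defs where

open import Data.Nat using (ℕ; zero; suc)
open import Data.Bool using (Bool; true; false; _∧_; _∨_)
open import Data.Fin using (Fin; zero; suc)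
open import Data.Fin.Subset using (Subset; _∈_; ∣_∣)
open import Data.Vec using (tabulate; lookup)
open import Data.Integer using (ℤ; _-_; _≤_; +_)
open import Data.Product using (Σ; _×_; ∃)
open import Data.Empty using (⊥)
open import Relation.Binary.PropositionalEquality using (_≡_)

record SimpleGraph (n : ℕ) : Set where
  field
    adj    : Fin n → Fin n → Bool
    sym    : ∀ u v → adj u v ≡ adj v u
    irrefl : ∀ v → adj v v ≡ false

open SimpleGraph public

anyFin : ∀ {n} → (Fin n → Bool) → Bool
anyFin {zero}  f = false
anyFin {suc n} f = f zero ∨ anyFin (λ i → f (suc i))

module _ {n : ℕ} (G : SimpleGraph n) where

  Adj : Fin n → Fin n → Set
  Adj u v = adj G u v ≡ true

  N : Subset n → Subset n
  N X = tabulate (λ v → anyFin (λ u → lookup X u ∧ adj G u v))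

  d : Subset n → ℤ
  d X = + ∣ X ∣ - + ∣ N X ∣

  Independent : Subset n → Set
  Independent S = ∀ u v → u ∈ S → v ∈ S → Adj u v → ⊥

  Critical : Subset n → Set
  Critical A = ∀ Y → d Y ≤ d A

  CriticalIndependent : Subset n → Set
  CriticalIndependent A = Independent A × Critical A

  MaxCriticalIndependent : Subset n → Set
  MaxCriticalIndependent A =
    CriticalIndependent A × (∀ B → CriticalIndependent B → ∣ B ∣ Data.Nat.≤ ∣ A ∣)

  InDiadem : Fin n → Set
  InDiadem v = ∃ λ A → MaxCriticalIndependent A × v ∈ A

  InNucleus : Fin n → Set
  InNucleus v = ∀ A → MaxCriticalIndependent A → v ∈ A

  IsDiadem : Subset n → Set
  IsDiadem D = ∀ v → (v ∈ D → InDiadem v) × (InDiadem v → v ∈ D)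

  IsNucleus : Subset n → Set
  IsNucleus K = ∀ v → (v ∈ K → InNucleus v) × (InNucleus v → v ∈ K)

  IsIndependenceNumber : ℕ → Set
  IsIndependenceNumber a =
    (∃ λ S → Independent S × ∣ S ∣ ≡ a) × (∀ S → Independent S → ∣ S ∣ Data.Nat.≤ a)

-- Fix one maximum critical independent set A. The nucleus K lies inside A. Every vertex of a
-- critical independent set B that is not in N(A) lies in A: otherwise A ∪ ((A ∪ B) ∖ N(A ∪ B))
-- would be a larger critical independent set, because d is supermodular (so unions of critical
-- sets are critical) and removing N(Y) from Y never decreases d. Hence the diadem lies in
-- A ∪ (N(A) ∖ N(K)), and |K| + |N(A) ∖ N(K)| ≤ |A| is the inequality d(K) ≤ d(A). So
-- |K| + |diadem| ≤ 2|A| ≤ 2α.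
module Submission where

module _ where
  open import Data.Integer using (+_; _+_; _-_; -_; _≤_; +≤+)
  open import Data.Integer.Properties using (pos-+; +-monoˡ-≤; +-monoʳ-≤; ≤-trans; drop‿+≤+; module ≤-Reasoning)
  open import Data.Integer.Tactic.RingSolver using (solve-∀)
  import Data.Nat as ℕ
  open import Relation.Binary.PropositionalEquality using (_≡_; cong; sym)
  open ≤-Reasoning

  diff-+-diff : ∀ a b c e → (+ a - + b) + (+ c - + e) ≡ + (a ℕ.+ c) - + (b ℕ.+ e)
  diff-+-diff a b c e rewrite pos-+ a c | pos-+ b e = interchange (+ a) (+ b) (+ c) (+ e)
    where
    interchange : ∀ w x y z → (w - x) + (y - z) ≡ (w + y) - (x + z)
    interchange = solve-∀

  diff-≤⁺ : ∀ {a b c e} → a ℕ.+ e ℕ.≤ c ℕ.+ b → + a - + b ≤ + c - + e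
  diff-≤⁺ {a} {b} {c} {e} a+e≤c+b = begin
    + a - + b               ≡⟨ extend (+ a) (+ b) (+ e) ⟩
    (+ a + + e) - k         ≡⟨ cong (_- k) (pos-+ a e) ⟨
    + (a ℕ.+ e) - k         ≤⟨ +-monoˡ-≤ (- k) (+≤+ a+e≤c+b) ⟩
    + (c ℕ.+ b) - k         ≡⟨ cong (_- k) (pos-+ c b) ⟩
    (+ c + + b) - k         ≡⟨ reduce (+ c) (+ b) (+ e) ⟩
    + c - + e               ∎
    where
    k = + b + + e
    extend : ∀ x y z → x - y ≡ (x + z) - (y + z)
    extend = solve-∀
    reduce : ∀ x y z → (x + y) - (y + z) ≡ x - z
    reduce = solve-∀

  diff-≤⁻ : ∀ {a b c e} → + a - + b ≤ + c - + e → a ℕ.+ e ℕ.≤ c ℕ.+ b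
  diff-≤⁻ {a} {b} {c} {e} le = drop‿+≤+ (begin
    + (a ℕ.+ e)               ≡⟨ pos-+ a e ⟩
    + a + + e                 ≡⟨ restoreˡ (+ a) (+ b) (+ e) ⟨
    (+ a - + b) + (+ b + + e) ≤⟨ +-monoˡ-≤ (+ b + + e) le ⟩
    (+ c - + e) + (+ b + + e) ≡⟨ restoreʳ (+ c) (+ e) (+ b) ⟩
    + c + + b                 ≡⟨ pos-+ c b ⟨
    + (c ℕ.+ b)               ∎)
    where
    restoreˡ : ∀ x y z → (x - y) + (y + z) ≡ x + z
    restoreˡ = solve-∀
    restoreʳ : ∀ x y z → (x - y) + (z + y) ≡ x + z
    restoreʳ = solve-∀

  i+j≤k+l∧l≤j⇒i≤k : ∀ {i j k l} → i + j ≤ k + l → l ≤ j → i ≤ k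
  i+j≤k+l∧l≤j⇒i≤k {i} {j} {k} {l} i+j≤k+l l≤j = begin
    i             ≡⟨ addSub i j ⟩
    (i + j) - j   ≤⟨ +-monoˡ-≤ (- j) (≤-trans i+j≤k+l (+-monoʳ-≤ k l≤j)) ⟩
    (k + j) - j   ≡⟨ addSub k j ⟨
    k             ∎
    where
    addSub : ∀ x y → x ≡ (x + y) - y
    addSub = solve-∀

open import Defs renaming (sym to adj-sym)
open import Data.Bool using (Bool; true; false; _∧_)
open import Data.Bool.Properties using (∧-conicalˡ; ∧-conicalʳ)
import Data.Bool as Bool
open import Data.Fin using (Fin; zero; suc)
open import Data.Fin.Properties using (all?)
open import Data.Fin.Subset using (Subset; ∣_∣; _∈_; _∉_; _⊆_; _∪_; _∩_; _─_; inside; outside) renaming (⊥ to ∅)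
open import Data.Fin.Subset.Properties
  using (_∈?_; p⊆q⇒∣p∣≤∣q∣; p⊂q⇒∣p∣<∣q∣; p⊆p∪q; q⊆p∪q; p∩q⊆p; p∩q⊆q; ∩-comm; p─q⊆p;
         x∈p∪q⁺; x∈p∪q⁻; x∈p∩q⁺; x∈p∧x∉q⇒x∈p─q)
open import Data.Integer as ℤ using (ℤ; +_)
import Data.Integer.Properties as ℤ
open import Data.Nat using (ℕ; zero; suc; _+_; _*_; _≤_)
open import Data.Nat.Properties
  using (+-suc; +-comm; +-assoc; +-identityʳ; m≤m+n; ≤-trans; ≤-reflexive; +-mono-≤; +-monoˡ-≤; +-monoʳ-≤;
         +-cancelʳ-≤; <⇒≱; module ≤-Reasoning)
open import Data.Product using (∃; _×_; _,_; proj₁)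
open import Data.Sum using (_⊎_; inj₁; inj₂)
open import Data.Unit using (⊤; tt)
open import Data.Vec using ([]; _∷_; here; there; lookup)
open import Data.Vec.Properties using (lookup∘tabulate; []=⇒lookup; lookup⇒[]=)
open import Function using (_∘_)
open import Relation.Nullary using (¬_; yes; no; contradiction; ¬?; _→-dec_; _×-dec_; map′)
open import Relation.Unary using (Decidable)
open import Relation.Binary.PropositionalEquality using (_≡_; refl; sym; trans; cong; cong₂; subst₂)

∣p∪q∣+∣p∩q∣≡∣p∣+∣q∣ : ∀ {n} (p q : Subset n) → ∣ p ∪ q ∣ + ∣ p ∩ q ∣ ≡ ∣ p ∣ + ∣ q ∣
∣p∪q∣+∣p∩q∣≡∣p∣+∣q∣ []            []            = refl
∣p∪q∣+∣p∩q∣≡∣p∣+∣q∣ (inside  ∷ p) (inside  ∷ q) =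
  cong suc (trans (+-suc _ _) (trans (cong suc (∣p∪q∣+∣p∩q∣≡∣p∣+∣q∣ p q)) (sym (+-suc _ _))))
∣p∪q∣+∣p∩q∣≡∣p∣+∣q∣ (inside  ∷ p) (outside ∷ q) = cong suc (∣p∪q∣+∣p∩q∣≡∣p∣+∣q∣ p q)
∣p∪q∣+∣p∩q∣≡∣p∣+∣q∣ (outside ∷ p) (inside  ∷ q) =
  trans (cong suc (∣p∪q∣+∣p∩q∣≡∣p∣+∣q∣ p q)) (sym (+-suc _ _))
∣p∪q∣+∣p∩q∣≡∣p∣+∣q∣ (outside ∷ p) (outside ∷ q) = ∣p∪q∣+∣p∩q∣≡∣p∣+∣q∣ p q

∣p─q∣+∣p∩q∣≡∣p∣ : ∀ {n} (p q : Subset n) → ∣ p ─ q ∣ + ∣ p ∩ q ∣ ≡ ∣ p ∣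
∣p─q∣+∣p∩q∣≡∣p∣ []            []            = refl
∣p─q∣+∣p∩q∣≡∣p∣ (inside  ∷ p) (inside  ∷ q) = trans (+-suc _ _) (cong suc (∣p─q∣+∣p∩q∣≡∣p∣ p q))
∣p─q∣+∣p∩q∣≡∣p∣ (inside  ∷ p) (outside ∷ q) = cong suc (∣p─q∣+∣p∩q∣≡∣p∣ p q)
∣p─q∣+∣p∩q∣≡∣p∣ (outside ∷ p) (inside  ∷ q) = ∣p─q∣+∣p∩q∣≡∣p∣ p q
∣p─q∣+∣p∩q∣≡∣p∣ (outside ∷ p) (outside ∷ q) = ∣p─q∣+∣p∩q∣≡∣p∣ p q

∣p∪q∣≤∣p∣+∣q∣ : ∀ {n} (p q : Subset n) → ∣ p ∪ q ∣ ≤ ∣ p ∣ + ∣ q ∣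
∣p∪q∣≤∣p∣+∣q∣ p q = ≤-trans (m≤m+n _ ∣ p ∩ q ∣) (≤-reflexive (∣p∪q∣+∣p∩q∣≡∣p∣+∣q∣ p q))

x∈p─q⇒x∉q : ∀ {n} {x : Fin n} (p q : Subset n) → x ∈ p ─ q → x ∉ q
x∈p─q⇒x∉q (_ ∷ p) (outside ∷ q) here          ()
x∈p─q⇒x∉q (_ ∷ p) (_       ∷ q) (there x∈p─q) (there x∈q) = x∈p─q⇒x∉q p q x∈p─q x∈q

argmax : ∀ {m} {P : Subset m → Set} → Decidable P → (f : Subset m → ℤ) →
         (∀ X → ¬ P X) ⊎ ∃ λ X → P X × ∀ Y → P Y → f Y ℤ.≤ f X
argmax {zero} P? f with P? []
... | yes p = inj₂ ([] , p , λ { [] _ → ℤ.≤-refl })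
... | no ¬p = inj₁ λ { [] → ¬p }
argmax {suc m} P? f
  with argmax (P? ∘ (inside ∷_)) (f ∘ (inside ∷_)) | argmax (P? ∘ (outside ∷_)) (f ∘ (outside ∷_))
... | inj₁ noIn | inj₁ noOut = inj₁ λ { (inside ∷ X) → noIn X ; (outside ∷ X) → noOut X }
... | inj₂ (X , p , maxIn) | inj₁ noOut =
  inj₂ (inside ∷ X , p , λ { (inside ∷ Y) q → maxIn Y q ; (outside ∷ Y) q → contradiction q (noOut Y) })
... | inj₁ noIn | inj₂ (X , p , maxOut) =
  inj₂ (outside ∷ X , p , λ { (outside ∷ Y) q → maxOut Y q ; (inside ∷ Y) q → contradiction q (noIn Y) })
... | inj₂ (X , p , maxIn) | inj₂ (X′ , p′ , maxOut) with ℤ.≤-total (f (inside ∷ X)) (f (outside ∷ X′))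
...   | inj₁ le = inj₂ (outside ∷ X′ , p′ ,
          λ { (outside ∷ Y) q → maxOut Y q ; (inside ∷ Y) q → ℤ.≤-trans (maxIn Y q) le })
...   | inj₂ le = inj₂ (inside ∷ X , p ,
          λ { (inside ∷ Y) q → maxIn Y q ; (outside ∷ Y) q → ℤ.≤-trans (maxOut Y q) le })

anyFin⁺ : ∀ {n} (f : Fin n → Bool) i → f i ≡ true → anyFin f ≡ true
anyFin⁺ f zero    fi = cong (Bool._∨ anyFin (f ∘ suc)) fi
anyFin⁺ f (suc i) fi with f zero
... | true  = refl
... | false = anyFin⁺ (f ∘ suc) i fi

anyFin⁻ : ∀ {n} (f : Fin n → Bool) → anyFin f ≡ true → ∃ λ i → f i ≡ true
anyFin⁻ {suc n} f any with f zero in f0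
... | true  = zero , f0
... | false with anyFin⁻ (f ∘ suc) any
...   | i , fi = suc i , fi

module _ {n : ℕ} (G : SimpleGraph n) where

  Adj-sym : ∀ {u v} → Adj G u v → Adj G v u
  Adj-sym {u} {v} = trans (adj-sym G v u)

  ∈N⁺ : ∀ {X u v} → u ∈ X → Adj G u v → v ∈ N G X
  ∈N⁺ {X} {u} {v} u∈X uv = lookup⇒[]= v _
    (trans (lookup∘tabulate _ v) (anyFin⁺ _ u (cong₂ _∧_ ([]=⇒lookup u∈X) uv)))

  ∈N⁻ : ∀ {X v} → v ∈ N G X → ∃ λ u → u ∈ X × Adj G u v
  ∈N⁻ {X} {v} v∈NX with anyFin⁻ _ (trans (sym (lookup∘tabulate _ v)) ([]=⇒lookup v∈NX))
  ... | u , Xu∧uv = u , lookup⇒[]= u X (∧-conicalˡ _ _ Xu∧uv) , ∧-conicalʳ (lookup X u) _ Xu∧uv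

  N-mono : ∀ {X Y} → X ⊆ Y → N G X ⊆ N G Y
  N-mono X⊆Y v∈NX with ∈N⁻ v∈NX
  ... | u , u∈X , uv = ∈N⁺ (X⊆Y u∈X) uv

  N-∪ : ∀ X Y → N G (X ∪ Y) ⊆ N G X ∪ N G Y
  N-∪ X Y v∈N with ∈N⁻ v∈N
  ... | u , u∈X∪Y , uv with x∈p∪q⁻ X Y u∈X∪Y
  ...   | inj₁ u∈X = x∈p∪q⁺ (inj₁ (∈N⁺ u∈X uv))
  ...   | inj₂ u∈Y = x∈p∪q⁺ (inj₂ (∈N⁺ u∈Y uv))

  N-∩ : ∀ X Y → N G (X ∩ Y) ⊆ N G X ∩ N G Y
  N-∩ X Y v∈N = x∈p∩q⁺ (N-mono (p∩q⊆p X Y) v∈N , N-mono (p∩q⊆q X Y) v∈N)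

  Independent⇒∉N : ∀ {S v} → Independent G S → v ∈ S → v ∉ N G S
  Independent⇒∉N indS v∈S v∈NS with ∈N⁻ v∈NS
  ... | u , u∈S , uv = indS u _ u∈S v∈S uv

  ∣N∣-submodular : ∀ X Y → ∣ N G (X ∪ Y) ∣ + ∣ N G (X ∩ Y) ∣ ≤ ∣ N G X ∣ + ∣ N G Y ∣
  ∣N∣-submodular X Y =
    ≤-trans (+-mono-≤ (p⊆q⇒∣p∣≤∣q∣ (N-∪ X Y)) (p⊆q⇒∣p∣≤∣q∣ (N-∩ X Y)))
            (≤-reflexive (∣p∪q∣+∣p∩q∣≡∣p∣+∣q∣ (N G X) (N G Y)))

  d-supermodular : ∀ X Y → d G X ℤ.+ d G Y ℤ.≤ d G (X ∪ Y) ℤ.+ d G (X ∩ Y)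
  d-supermodular X Y =
    subst₂ ℤ._≤_ (sym (diff-+-diff (∣ X ∣) (∣ N G X ∣) (∣ Y ∣) (∣ N G Y ∣)))
                 (sym (diff-+-diff (∣ X ∪ Y ∣) (∣ N G (X ∪ Y) ∣) (∣ X ∩ Y ∣) (∣ N G (X ∩ Y) ∣)))
      (diff-≤⁺ {∣ X ∣ + ∣ Y ∣} {∣ N G X ∣ + ∣ N G Y ∣}
        (+-mono-≤ (≤-reflexive (sym (∣p∪q∣+∣p∩q∣≡∣p∣+∣q∣ X Y))) (∣N∣-submodular X Y)))

  Critical-∪ : ∀ X Y → Critical G X → Critical G Y → Critical G (X ∪ Y)
  Critical-∪ X Y critX critY Z =
    ℤ.≤-trans (critX Z) (i+j≤k+l∧l≤j⇒i≤k (d-supermodular X Y) (critY (X ∩ Y)))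

  core : Subset n → Subset n
  core Y = Y ─ N G Y

  core-independent : ∀ Y → Independent G (core Y)
  core-independent Y u w u∈ w∈ uw =
    x∈p─q⇒x∉q Y (N G Y) w∈ (∈N⁺ (p─q⊆p Y (N G Y) u∈) uw)

  Independent-∪-core : ∀ {A Y} → Independent G A → A ⊆ Y → Independent G (A ∪ core Y)
  Independent-∪-core {A} {Y} indA A⊆Y u w u∈ w∈ uw with x∈p∪q⁻ A _ u∈ | x∈p∪q⁻ A _ w∈
  ... | inj₁ u∈A | inj₁ w∈A = indA u w u∈A w∈A uw
  ... | inj₁ u∈A | inj₂ w∈C = x∈p─q⇒x∉q Y (N G Y) w∈C (∈N⁺ (A⊆Y u∈A) uw)
  ... | inj₂ u∈C | inj₁ w∈A = x∈p─q⇒x∉q Y (N G Y) u∈C (∈N⁺ (A⊆Y w∈A) (Adj-sym uw))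
  ... | inj₂ u∈C | inj₂ w∈C = core-independent Y u w u∈C w∈C uw

  N-core⊆ : ∀ Y → N G (core Y) ⊆ N G Y ─ Y
  N-core⊆ Y v∈N with ∈N⁻ v∈N
  ... | u , u∈C , uv = x∈p∧x∉q⇒x∈p─q (N-mono (p─q⊆p Y (N G Y)) v∈N)
                         (λ v∈Y → x∈p─q⇒x∉q Y (N G Y) u∈C (∈N⁺ v∈Y (Adj-sym uv)))

  d≤d-core : ∀ Y → d G Y ℤ.≤ d G (core Y)
  d≤d-core Y = diff-≤⁺ {∣ Y ∣} {∣ NY ∣} {∣ C ∣} {∣ N G C ∣} (begin
    ∣ Y ∣ + ∣ N G C ∣                             ≡⟨ cong (_+ ∣ N G C ∣) (∣p─q∣+∣p∩q∣≡∣p∣ Y NY) ⟨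
    ∣ C ∣ + ∣ Y ∩ NY ∣ + ∣ N G C ∣                 ≤⟨ +-monoʳ-≤ (∣ C ∣ + ∣ Y ∩ NY ∣) (p⊆q⇒∣p∣≤∣q∣ (N-core⊆ Y)) ⟩
    ∣ C ∣ + ∣ Y ∩ NY ∣ + ∣ NY ─ Y ∣                ≡⟨ +-assoc ∣ C ∣ _ _ ⟩
    ∣ C ∣ + (∣ Y ∩ NY ∣ + ∣ NY ─ Y ∣)              ≡⟨ cong (_+_ ∣ C ∣) (+-comm ∣ Y ∩ NY ∣ _) ⟩
    ∣ C ∣ + (∣ NY ─ Y ∣ + ∣ Y ∩ NY ∣)              ≡⟨ cong (λ S → ∣ C ∣ + (∣ NY ─ Y ∣ + ∣ S ∣)) (∩-comm Y NY) ⟩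
    ∣ C ∣ + (∣ NY ─ Y ∣ + ∣ NY ∩ Y ∣)              ≡⟨ cong (_+_ ∣ C ∣) (∣p─q∣+∣p∩q∣≡∣p∣ NY Y) ⟩
    ∣ C ∣ + ∣ NY ∣                                 ∎)
    where
    open ≤-Reasoning
    C = core Y
    NY = N G Y

  Critical-core : ∀ Y → Critical G Y → Critical G (core Y)
  Critical-core Y critY Z = ℤ.≤-trans (critY Z) (d≤d-core Y)

  x∈B∧x∉NA⇒x∈A : ∀ {A B x} → MaxCriticalIndependent G A → CriticalIndependent G B →
                 x ∈ B → x ∉ N G A → x ∈ A
  x∈B∧x∉NA⇒x∈A {A} {B} {x} ((indA , critA) , maxA) (indB , critB) x∈B x∉NA with x ∈? A
  ... | yes x∈A = x∈A
  ... | no  x∉A = contradiction (maxA W (indW , critW)) (<⇒≱ (p⊂q⇒∣p∣<∣q∣ (p⊆p∪q _ , x , x∈W , x∉A)))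
    where
    Y = A ∪ B
    W = A ∪ core Y
    indW : Independent G W
    indW = Independent-∪-core indA (p⊆p∪q B)
    critW : Critical G W
    critW = Critical-∪ A (core Y) critA (Critical-core Y (Critical-∪ A B critA critB))
    x∉NY : x ∉ N G Y
    x∉NY x∈NY with x∈p∪q⁻ (N G A) (N G B) (N-∪ A B x∈NY)
    ... | inj₁ x∈NA = x∉NA x∈NA
    ... | inj₂ x∈NB = Independent⇒∉N indB x∈B x∈NB
    x∈W : x ∈ W
    x∈W = q⊆p∪q A _ (x∈p∧x∉q⇒x∈p─q (q⊆p∪q A B x∈B) x∉NY)

  independent? : Decidable (Independent G)
  independent? S = all? λ u → all? λ v → u ∈? S →-dec v ∈? S →-dec ¬? (adj G u v Bool.≟ true)

  Critical-exists : ∃ (Critical G)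
  Critical-exists with argmax {P = λ _ → ⊤} (λ _ → yes tt) (d G)
  ... | inj₁ none = contradiction tt (none ∅)
  ... | inj₂ (X , _ , maxX) = X , λ Y → maxX Y tt

  criticalIndependent? : ∀ X → Critical G X → Decidable (CriticalIndependent G)
  criticalIndependent? X critX S =
    independent? S ×-dec map′ (λ le Y → ℤ.≤-trans (critX Y) le) (λ critS → critS X) (d G X ℤ.≤? d G S)

  maxCriticalIndependent-exists : ∃ (MaxCriticalIndependent G)
  maxCriticalIndependent-exists with Critical-exists
  ... | X , critX with argmax (criticalIndependent? X critX) (λ S → + ∣ S ∣)
  ...   | inj₁ none = contradiction (core-independent X , Critical-core X critX) (none (core X))
  ...   | inj₂ (A , ciA , maxA) = A , ciA , λ B ciB → ℤ.drop‿+≤+ (maxA B ciB)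

  nucleus⊆ : ∀ {K A} → IsNucleus G K → MaxCriticalIndependent G A → K ⊆ A
  nucleus⊆ isK maxA {v} v∈K = proj₁ (isK v) v∈K _ maxA

  diadem⊆ : ∀ {D K A} → IsDiadem G D → IsNucleus G K → MaxCriticalIndependent G A →
            D ⊆ (N G A ─ N G K) ∪ A
  diadem⊆ {A = A} isD isK maxA {v} v∈D with proj₁ (isD v) v∈D
  ... | B , maxB , v∈B with v ∈? N G A
  ...   | no  v∉NA = q⊆p∪q _ A (x∈B∧x∉NA⇒x∈A maxA (proj₁ maxB) v∈B v∉NA)
  ...   | yes v∈NA = p⊆p∪q A (x∈p∧x∉q⇒x∈p─q v∈NA
                        (Independent⇒∉N (proj₁ (proj₁ maxB)) v∈B ∘ N-mono (nucleus⊆ isK maxB)))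

  ∣X∣+∣NA─NX∣≤∣A∣ : ∀ {X A} → X ⊆ A → Critical G A → ∣ X ∣ + ∣ N G A ─ N G X ∣ ≤ ∣ A ∣
  ∣X∣+∣NA─NX∣≤∣A∣ {X} {A} X⊆A critA = +-cancelʳ-≤ ∣ N G X ∣ _ _ (begin
    ∣ X ∣ + ∣ NA ─ NX ∣ + ∣ NX ∣         ≡⟨ +-assoc ∣ X ∣ _ _ ⟩
    ∣ X ∣ + (∣ NA ─ NX ∣ + ∣ NX ∣)       ≤⟨ +-monoʳ-≤ ∣ X ∣ (+-monoʳ-≤ ∣ NA ─ NX ∣ ∣NX∣≤∣NA∩NX∣) ⟩
    ∣ X ∣ + (∣ NA ─ NX ∣ + ∣ NA ∩ NX ∣)   ≡⟨ cong (_+_ ∣ X ∣) (∣p─q∣+∣p∩q∣≡∣p∣ NA NX) ⟩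
    ∣ X ∣ + ∣ NA ∣                       ≤⟨ diff-≤⁻ {∣ X ∣} {∣ NX ∣} (critA X) ⟩
    ∣ A ∣ + ∣ NX ∣                       ∎)
    where
    open ≤-Reasoning
    NA = N G A
    NX = N G X
    ∣NX∣≤∣NA∩NX∣ : ∣ NX ∣ ≤ ∣ NA ∩ NX ∣
    ∣NX∣≤∣NA∩NX∣ = p⊆q⇒∣p∣≤∣q∣ λ v∈NX → x∈p∩q⁺ (N-mono X⊆A v∈NX , v∈NX)

theorem1p7 : ∀ (n : ℕ) (G : SimpleGraph n) (D K : Subset n) (a : ℕ) →
    IsDiadem G D → IsNucleus G K → IsIndependenceNumber G a →
    ∣ K ∣ + ∣ D ∣ ≤ 2 * a
theorem1p7 _ G D K a isD isK (_ , α-max) with maxCriticalIndependent-exists G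
... | A , maxA@((indA , critA) , _) = begin
  ∣ K ∣ + ∣ D ∣                ≤⟨ +-monoʳ-≤ ∣ K ∣ (≤-trans (p⊆q⇒∣p∣≤∣q∣ (diadem⊆ G isD isK maxA)) (∣p∪q∣≤∣p∣+∣q∣ P A)) ⟩
  ∣ K ∣ + (∣ P ∣ + ∣ A ∣)      ≡⟨ +-assoc ∣ K ∣ _ _ ⟨
  ∣ K ∣ + ∣ P ∣ + ∣ A ∣        ≤⟨ +-monoˡ-≤ ∣ A ∣ (∣X∣+∣NA─NX∣≤∣A∣ G (nucleus⊆ G isK maxA) critA) ⟩
  ∣ A ∣ + ∣ A ∣                ≤⟨ +-mono-≤ ∣A∣≤a ∣A∣≤a ⟩
  a + a                        ≡⟨ cong (_+_ a) (+-identityʳ a) ⟨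
  2 * a                        ∎
  where
  open ≤-Reasoning
  P = N G A ─ N G K
  ∣A∣≤a : ∣ A ∣ ≤ a
  ∣A∣≤a = α-max A indA
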